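{- Let $n\geq 2$, let $a_1,\dots,a_n$ be positive integers, let $1\leq i\leq n$, and let $G=S_n(a_1,\dots,a_i,\dots,a_n)$ and $G'=S_n(a_1,\dots,a_i+1,\dots,a_n)$ (the palm obtained by lengthening the $i$-th path by one vertex). Then $\chi_L(G')\geq\chi_L(G)-1$.
   Context: For a simple connected graph $G=(V,E)$, a $k$-coloring is a map $c:V\to\{1,\dots,k\}$ with adjacent vertices receiving different colors; $c^{ -1}(i)$ denotes the $i$-th color class, and $d(u,S)=\min_{v\in S}d(u,v)$. The color code of $v$ is $r_c(v)=(d(v,c^{ -1}(1)),\dots,d(v,c^{ -1}(k)))$. The coloring $c$ is a locating coloring if distinct vertices have distinct color codes. The locating chromatic number $\chi_L(G)$ is the least $k$ such that $G$ has a locating $k$-coloring. For $n\geq 2$ and positive integers $a_1,\dots,a_n$, the palm $S_n(a_1,\dots,a_n)$ is the tree consisting of $n$ paths of lengths $a_1,\dots,a_n$ sharing one common endpoint (the hub), otherwise disjoint. -}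

module Defs where

open import Data.Nat using (ℕ; zero; suc; _+_; _≤_; _<_)
open import Data.Fin using (Fin; toℕ) renaming (zero to fzero; suc to fsuc)
open import Data.Fin.Properties using (_≟_)
open import Data.Product using (Σ; ∃; _×_; _,_)
open import Relation.Binary.PropositionalEquality using (_≡_; _≢_)
open import Relation.Nullary using (¬_; yes; no)

record Graph : Set₁ where
  field
    V   : Set
    Adj : V → V → Set

module _ (G : Graph) where
  open Graph G

  data Walk : V → V → ℕ → Set where
    here : ∀ {u} → Walk u u 0
    step : ∀ {u v w m} → Adj u v → Walk v w m → Walk u w (suc m)

  Dist : V → V → ℕ → Set
  Dist u v m = Walk u v m × (∀ m′ → Walk u v m′ → m ≤ m′)

  DistSet : V → (V → Set) → ℕ → Set
  DistSet u S m = (Σ V λ v → S v × Dist u v m) × (∀ v m′ → S v → Dist u v m′ → m ≤ m′)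

  Proper : ∀ {k} → (V → Fin k) → Set
  Proper c = ∀ u v → Adj u v → c u ≢ c v

  ColorClass : ∀ {k} → (V → Fin k) → Fin k → V → Set
  ColorClass c i v = c v ≡ i

  Surjective : ∀ {k} → (V → Fin k) → Set
  Surjective c = ∀ i → Σ V λ v → c v ≡ i

  -- distinct vertices have distinct color codes
  -- (r_c(u) ≠ r_c(v): some coordinate i differs)
  CodesDistinct : ∀ {k} → (V → Fin k) → Set
  CodesDistinct {k} c = ∀ u v → u ≢ v →
    Σ (Fin k) λ i → Σ ℕ λ m → Σ ℕ λ m′ →
      DistSet u (ColorClass c i) m × DistSet v (ColorClass c i) m′ × m ≢ m′

  LocatingColoring : (k : ℕ) → (V → Fin k) → Set
  LocatingColoring k c = Proper c × Surjective c × CodesDistinct c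

  HasLocatingColoring : ℕ → Set
  HasLocatingColoring k = Σ (V → Fin k) (LocatingColoring k)

  IsLocChromNum : ℕ → Set
  IsLocChromNum k = HasLocatingColoring k × (∀ j → j < k → ¬ HasLocatingColoring j)

-- Palm S_n(a_1,…,a_n): the hub plus, for each path j, vertices leg j t
-- (t : Fin (a j)) at distance t+1 from the hub along path j.
data PalmV {n : ℕ} (a : Fin n → ℕ) : Set where
  hub : PalmV a
  leg : (j : Fin n) → Fin (a j) → PalmV a

data PalmAdj {n : ℕ} (a : Fin n → ℕ) : PalmV a → PalmV a → Set where
  hub-leg  : ∀ j (t : Fin (a j)) → toℕ t ≡ 0 → PalmAdj a hub (leg j t)
  leg-hub  : ∀ j (t : Fin (a j)) → toℕ t ≡ 0 → PalmAdj a (leg j t) hub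
  leg-next : ∀ j (s t : Fin (a j)) → toℕ t ≡ suc (toℕ s) → PalmAdj a (leg j s) (leg j t)
  leg-prev : ∀ j (s t : Fin (a j)) → toℕ s ≡ suc (toℕ t) → PalmAdj a (leg j s) (leg j t)

Palm : {n : ℕ} → (Fin n → ℕ) → Graph
Palm a = record { V = PalmV a ; Adj = PalmAdj a }

lengthen : {n : ℕ} → (Fin n → ℕ) → Fin n → Fin n → ℕ
lengthen a i j with j ≟ i
... | yes _ = suc (a j)
... | no  _ = a j

module Submission where

-- Take a locating coloring c′ of the lengthened palm G′ and restrict it to G, where G is
-- G′ minus the new end vertex x of the i-th path; recolor the old end vertex y of that path
-- with a fresh color. Vertices at different distances from y are separated by the fresh
-- color. If u and v are equidistant from y, then the only vertices of a c′-class that may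
-- have left the corresponding restricted class, namely y and x, lie at the same distances
-- d(u,y) and d(u,y) + 1 from u and from v. So if the restricted class did not separate u
-- and v, the c′-class would not separate them either. Hence G has a proper coloring with
-- distinct codes in χ_L(G′) + 1 colors, and discarding unused colors makes it locating.

open import Defs
open import Data.Nat as ℕ using (ℕ; zero; suc; _≤_; _<_; _+_; z≤n; s≤s; ∣_-_∣; >-nonZero)
import Data.Nat.Properties as ℕₚ
open import Data.Fin using (Fin; toℕ; fromℕ<; inject₁; fromℕ; punchOut)
open import Data.Fin.Properties
  using (_≟_; toℕ-injective; toℕ-fromℕ<; toℕ-inject₁; toℕ<n; punchOut-injective; punchOut-cong;
         fromℕ≢inject₁; inject₁-injective; all?; ¬∀⟶∃¬)
open import Data.List using (List; []; _∷_; map; _++_; allFin; filter)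
open import Data.List.Membership.Propositional using (_∈_; lose; find)
open import Data.List.Membership.Propositional.Properties
  using (∈-allFin; ∈-map⁺; ∈-++⁺ˡ; ∈-++⁺ʳ; ∈-filter⁺; ∈-filter⁻)
open import Data.List.Relation.Unary.Any using (here; there; any?)
open import Data.List.Relation.Unary.Any.Properties using (¬Any[])
import Data.List.Relation.Unary.All as All
open import Data.List.Extrema.Nat using (argmin; argmin-all; f[argmin]≤f[⊤]; f[argmin]≤f[xs])
open import Data.Maybe using (Maybe; just; nothing)
open import Data.Product using (Σ; _×_; _,_; proj₁; proj₂)
open import Data.Sum using (_⊎_; inj₁; inj₂)
open import Data.Empty using (⊥-elim)
open import Function using (_∘_)
open import Relation.Nullary using (¬_; Dec; yes; no)
open import Relation.Unary using (Decidable; _⊆_)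
open import Relation.Binary.PropositionalEquality

IsLocChromNum⇒≤ : ∀ {G k M} → IsLocChromNum G k → HasLocatingColoring G M → k ≤ M
IsLocChromNum⇒≤ {k = k} {M} (_ , least) hasM with k ℕ.≤? M
... | yes k≤M = k≤M
... | no  k≰M = ⊥-elim (least M (ℕₚ.≰⇒> k≰M) hasM)

module Walks (G : Graph) where
  open Graph G

  walk-snoc : ∀ {u v w m} → Walk G u v m → Adj v w → Walk G u w (suc m)
  walk-snoc here       e′ = step e′ here
  walk-snoc (step e p) e′ = step e (walk-snoc p e′)

  walk-reverse : (∀ {u v} → Adj u v → Adj v u) → ∀ {u v m} → Walk G u v m → Walk G v u m
  walk-reverse sym-adj here       = here
  walk-reverse sym-adj (step e p) = walk-snoc (walk-reverse sym-adj p) (sym-adj e)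

  walk-append : ∀ {u v w m l} → Walk G u v m → Walk G v w l → Walk G u w (m + l)
  walk-append here       q = q
  walk-append (step e p) q = step e (walk-append p q)

  walk-length-≥ : (δ : V → V → ℕ) → (∀ u → δ u u ≡ 0) →
                  (∀ {u u₁} v → Adj u u₁ → δ u v ≤ suc (δ u₁ v)) →
                  ∀ {u v m} → Walk G u v m → δ u v ≤ m
  walk-length-≥ δ δ-refl δ-step {u} here       = ℕₚ.≤-reflexive (δ-refl u)
  walk-length-≥ δ δ-refl δ-step {v = v} (step e p) =
    ℕₚ.≤-trans (δ-step v e) (s≤s (walk-length-≥ δ δ-refl δ-step p))

module UnusedColors (G : Graph) (vertices : List (Graph.V G))
                    (∈-vertices : ∀ v → v ∈ vertices) where
  open Graph G

  DistSet-cong : ∀ {u} {S T : V → Set} {m} → (∀ v → S v → T v) → (∀ v → T v → S v) →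
                 DistSet G u S m → DistSet G u T m
  DistSet-cong S⊆T T⊆S ((v , sv , d) , least) =
    (v , S⊆T v sv , d) , λ w m′ tw dw → least w m′ (T⊆S w tw) dw

  dropUnusedColors : ∀ m (c : V → Fin m) → Proper G c → CodesDistinct G c →
                     Σ ℕ λ M → M ≤ m × HasLocatingColoring G M
  dropUnusedColors zero c proper codes = 0 , z≤n , c , proper , (λ ()) , codes
  dropUnusedColors (suc m) c proper codes
    with all? (λ i → any? (λ v → c v ≟ i) vertices)
  ... | yes used = suc m , ℕₚ.≤-refl , c , proper , (λ i → let v , _ , cv = find (used i) in v , cv) , codes
  ... | no ¬used with ¬∀⟶∃¬ (suc m) _ (λ i → any? (λ v → c v ≟ i) vertices) ¬used
  ...   | i , unused =
    let M , M≤m , hasM = dropUnusedColors m c₋ proper₋ codes₋ in M , ℕₚ.m≤n⇒m≤1+n M≤m , hasM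
    where
    c≢i : ∀ v → i ≢ c v
    c≢i v i≡cv = unused (lose (∈-vertices v) (sym i≡cv))

    c₋ : V → Fin m
    c₋ v = punchOut (c≢i v)

    c₋-injective : ∀ {u v} → c₋ u ≡ c₋ v → c u ≡ c v
    c₋-injective {u} {v} = punchOut-injective (c≢i u) (c≢i v)

    proper₋ : Proper G c₋
    proper₋ u v e = proper u v e ∘ c₋-injective

    codes₋ : CodesDistinct G c₋
    codes₋ u v u≢v with codes u v u≢v
    ... | j , mu , mv , dsu@((w , cw≡j , _) , _) , dsv , mu≢mv =
      punchOut i≢j , mu , mv , DistSet-cong into out dsu , DistSet-cong into out dsv , mu≢mv
      where
      i≢j : i ≢ j
      i≢j i≡j = c≢i w (trans i≡j (sym cw≡j))

      into : ∀ x → ColorClass G c j x → ColorClass G c₋ (punchOut i≢j) x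
      into x = punchOut-cong i

      out : ∀ x → ColorClass G c₋ (punchOut i≢j) x → ColorClass G c j x
      out x = punchOut-injective (c≢i x) i≢j

module FiniteMetricGraph (G : Graph) (vertices : List (Graph.V G))
                         (∈-vertices : ∀ v → v ∈ vertices)
                         (d : Graph.V G → Graph.V G → ℕ)
                         (d-exact : ∀ u v → Dist G u v (d u v)) where
  open Graph G

  Dist⇒≡ : ∀ {u v m} → Dist G u v m → m ≡ d u v
  Dist⇒≡ {u} {v} (p , shortest) =
    ℕₚ.≤-antisym (shortest _ (proj₁ (d-exact u v))) (proj₂ (d-exact u v) _ p)

  Within : V → (V → Set) → ℕ → Set
  Within u S k = Σ V λ w → S w × d u w ≤ k

  DistSet-of-nearest : ∀ {u S} w → S w → (∀ v → S v → d u w ≤ d u v) → DistSet G u S (d u w)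
  DistSet-of-nearest {u} w sw nearest =
    (w , sw , d-exact u w) , λ v m sv dv → subst (d u w ≤_) (sym (Dist⇒≡ dv)) (nearest v sv)

  DistSet⇒Within : ∀ {u S m} → DistSet G u S m → Within u S m
  DistSet⇒Within ((w , sw , dw) , _) = w , sw , ℕₚ.≤-reflexive (sym (Dist⇒≡ dw))

  Within⇒DistSet≤ : ∀ {u S m k} → DistSet G u S m → Within u S k → m ≤ k
  Within⇒DistSet≤ {u} (_ , least) (w , sw , dw≤k) = ℕₚ.≤-trans (least w (d u w) sw (d-exact u w)) dw≤k

  Within⊆⇒DistSet≤ : ∀ {u v S T m m′} → DistSet G u S m → DistSet G v T m′ →
                     Within u S ⊆ Within v T → m′ ≤ m
  Within⊆⇒DistSet≤ dsu dsv S⊆T = Within⇒DistSet≤ dsv (S⊆T (DistSet⇒Within dsu))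

  nearest? : ∀ u {S : V → Set} → Decidable S → (∀ w → ¬ S w) ⊎ Σ ℕ (DistSet G u S)
  nearest? u {S} S? =
    search (filter S? vertices) (∈-filter⁺ S? (∈-vertices _)) (λ v∈ → proj₂ (∈-filter⁻ S? {xs = vertices} v∈))
    where
    search : ∀ xs → (∀ {v} → S v → v ∈ xs) → (∀ {v} → v ∈ xs → S v) → (∀ w → ¬ S w) ⊎ Σ ℕ (DistSet G u S)
    search []       complete _     = inj₁ λ w sw → ¬Any[] (complete sw)
    search (w ∷ ws) complete sound =
      inj₂ (_ , DistSet-of-nearest z (argmin-all (d u) (sound (here refl)) (All.tabulate (sound ∘ there)))
                                     λ v sv → minimal (complete sv))
      where
      z = argmin (d u) w ws

      minimal : ∀ {v} → v ∈ w ∷ ws → d u z ≤ d u v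
      minimal (here refl) = f[argmin]≤f[⊤] {f = d u} w ws
      minimal (there v∈)  = All.lookup (f[argmin]≤f[xs] {f = d u} w ws) v∈

  separates-or-Within-≡ : ∀ u v {S : V → Set} → Decidable S →
    (Σ ℕ λ p → Σ ℕ λ q → DistSet G u S p × DistSet G v S q × p ≢ q) ⊎
    (Within u S ⊆ Within v S × Within v S ⊆ Within u S)
  separates-or-Within-≡ u v S? with nearest? u S? | nearest? v S?
  ... | inj₁ none | _ = inj₂ ((λ (w , sw , _) → ⊥-elim (none w sw)) , λ (w , sw , _) → ⊥-elim (none w sw))
  ... | inj₂ (_ , ((w , sw , _) , _)) | inj₁ none = ⊥-elim (none w sw)
  ... | inj₂ (p , dsu) | inj₂ (q , dsv) with p ℕ.≟ q
  ...   | no p≢q  = inj₁ (p , q , dsu , dsv , p≢q)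
  ...   | yes refl = inj₂ (transfer dsu dsv , transfer dsv dsu)
    where
    transfer : ∀ {x y S m} → DistSet G x S m → DistSet G y S m → Within x S ⊆ Within y S
    transfer dsx dsy within =
      let w , sw , dw≤m = DistSet⇒Within dsy in w , sw , ℕₚ.≤-trans dw≤m (Within⇒DistSet≤ dsx within)

∣m-n∣≤1+∣1+m-n∣ : ∀ m n → ∣ m - n ∣ ≤ suc ∣ suc m - n ∣
∣m-n∣≤1+∣1+m-n∣ zero    zero    = z≤n
∣m-n∣≤1+∣1+m-n∣ zero    (suc n) = ℕₚ.≤-refl
∣m-n∣≤1+∣1+m-n∣ (suc m) zero    = ℕₚ.m≤n⇒m≤1+n (ℕₚ.n≤1+n _)
∣m-n∣≤1+∣1+m-n∣ (suc m) (suc n) = ∣m-n∣≤1+∣1+m-n∣ m n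

∣1+m-n∣≤1+∣m-n∣ : ∀ m n → ∣ suc m - n ∣ ≤ suc ∣ m - n ∣
∣1+m-n∣≤1+∣m-n∣ zero    zero    = ℕₚ.≤-refl
∣1+m-n∣≤1+∣m-n∣ zero    (suc n) = ℕₚ.m≤n⇒m≤1+n (ℕₚ.n≤1+n _)
∣1+m-n∣≤1+∣m-n∣ (suc m) zero    = ℕₚ.≤-refl
∣1+m-n∣≤1+∣m-n∣ (suc m) (suc n) = ∣1+m-n∣≤1+∣m-n∣ m n

m≤n⇒∣m-1+n∣≡1+∣m-n∣ : ∀ {m n} → m ≤ n → ∣ m - suc n ∣ ≡ suc ∣ m - n ∣
m≤n⇒∣m-1+n∣≡1+∣m-n∣ z≤n       = refl
m≤n⇒∣m-1+n∣≡1+∣m-n∣ (s≤s m≤n) = m≤n⇒∣m-1+n∣≡1+∣m-n∣ m≤n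

branch : ∀ {n} {b : Fin n → ℕ} → PalmV b → Maybe (Fin n)
branch hub       = nothing
branch (leg j _) = just j

depth : ∀ {n} {b : Fin n → ℕ} → PalmV b → ℕ
depth hub       = 0
depth (leg _ t) = suc (toℕ t)

posDist : ∀ {n} → Maybe (Fin n) → ℕ → Maybe (Fin n) → ℕ → ℕ
posDist nothing  p _        q = ∣ p - q ∣
posDist (just j) p nothing  q = ∣ p - q ∣
posDist (just j) p (just l) q with j ≟ l
... | yes _ = ∣ p - q ∣
... | no  _ = p + q

palmDist : ∀ {n} {b : Fin n → ℕ} → PalmV b → PalmV b → ℕ
palmDist u v = posDist (branch u) (depth u) (branch v) (depth v)

palmDist-by-position : ∀ {n} {b : Fin n → ℕ} {u v : PalmV b} {β γ p q} →
                       branch u ≡ β → depth u ≡ p → branch v ≡ γ → depth v ≡ q →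
                       palmDist u v ≡ posDist β p γ q
palmDist-by-position refl refl refl refl = refl

posDist-≤-outer : ∀ {n} (j : Fin n) p γ q → posDist (just j) p γ q ≤ suc (posDist (just j) (suc p) γ q)
posDist-≤-outer j p nothing  q = ∣m-n∣≤1+∣1+m-n∣ p q
posDist-≤-outer j p (just l) q with j ≟ l
... | yes _ = ∣m-n∣≤1+∣1+m-n∣ p q
... | no  _ = ℕₚ.m≤n⇒m≤1+n (ℕₚ.n≤1+n _)

posDist-≤-inner : ∀ {n} (j : Fin n) p γ q → posDist (just j) (suc p) γ q ≤ suc (posDist (just j) p γ q)
posDist-≤-inner j p nothing  q = ∣1+m-n∣≤1+∣m-n∣ p q
posDist-≤-inner j p (just l) q with j ≟ l
... | yes _ = ∣1+m-n∣≤1+∣m-n∣ p q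
... | no  _ = ℕₚ.≤-refl

posDist-≤-enter : ∀ {n} (j : Fin n) γ q → posDist nothing 0 γ q ≤ suc (posDist (just j) 1 γ q)
posDist-≤-enter j nothing  q = ∣m-n∣≤1+∣1+m-n∣ 0 q
posDist-≤-enter j (just l) q with j ≟ l
... | yes _ = ∣m-n∣≤1+∣1+m-n∣ 0 q
... | no  _ = ℕₚ.m≤n⇒m≤1+n (ℕₚ.n≤1+n _)

posDist-≤-leave : ∀ {n} (j : Fin n) γ q → posDist (just j) 1 γ q ≤ suc (posDist nothing 0 γ q)
posDist-≤-leave j nothing  q = ∣1+m-n∣≤1+∣m-n∣ 0 q
posDist-≤-leave j (just l) q with j ≟ l
... | yes _ = ∣1+m-n∣≤1+∣m-n∣ 0 q
... | no  _ = ℕₚ.≤-refl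

module PalmMetric {n : ℕ} (b : Fin n → ℕ) where
  open Walks (Palm b)

  _≟ᵥ_ : (u v : PalmV b) → Dec (u ≡ v)
  hub     ≟ᵥ hub     = yes refl
  hub     ≟ᵥ leg _ _ = no λ ()
  leg _ _ ≟ᵥ hub     = no λ ()
  leg j t ≟ᵥ leg l s with j ≟ l
  ... | no j≢l = no λ { refl → j≢l refl }
  ... | yes refl with t ≟ s
  ...   | yes refl = yes refl
  ...   | no t≢s   = no λ { refl → t≢s refl }

  ≡-by-position : ∀ (u v : PalmV b) → branch u ≡ branch v → depth u ≡ depth v → u ≡ v
  ≡-by-position hub       hub        _    _ = refl
  ≡-by-position (leg j t) (leg .j s) refl e = cong (leg j) (toℕ-injective (ℕₚ.suc-injective e))

  Adj-sym : ∀ {u v} → PalmAdj b u v → PalmAdj b v u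
  Adj-sym (hub-leg j t e)    = leg-hub j t e
  Adj-sym (leg-hub j t e)    = hub-leg j t e
  Adj-sym (leg-next j s t e) = leg-prev j t s e
  Adj-sym (leg-prev j s t e) = leg-next j t s e

  Adj-irrefl : ∀ {u v} → PalmAdj b u v → u ≢ v
  Adj-irrefl (leg-next j s t e) refl = ℕₚ.1+n≢n (sym e)
  Adj-irrefl (leg-prev j s t e) refl = ℕₚ.1+n≢n (sym e)

  legVertices : List (Fin n) → List (PalmV b)
  legVertices []       = []
  legVertices (j ∷ js) = map (leg j) (allFin (b j)) ++ legVertices js

  vertices : List (PalmV b)
  vertices = hub ∷ legVertices (allFin n)

  ∈-vertices : ∀ v → v ∈ vertices
  ∈-vertices hub       = here refl
  ∈-vertices (leg j t) = there (∈-legs (∈-allFin j))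
    where
    ∈-legs : ∀ {js} → j ∈ js → leg j t ∈ legVertices js
    ∈-legs {_ ∷ _}  (here refl) = ∈-++⁺ˡ (∈-map⁺ (leg j) (∈-allFin t))
    ∈-legs {l ∷ _} (there j∈)  = ∈-++⁺ʳ (map (leg l) (allFin (b l))) (∈-legs j∈)

  palmDist-self : ∀ (u : PalmV b) → palmDist u u ≡ 0
  palmDist-self hub = refl
  palmDist-self (leg j t) with j ≟ j
  ... | yes _  = ℕₚ.∣n-n∣≡0 (toℕ t)
  ... | no j≢j = ⊥-elim (j≢j refl)

  palmDist-step : ∀ {u u₁} v → PalmAdj b u u₁ → palmDist u v ≤ suc (palmDist u₁ v)
  palmDist-step v (hub-leg j t e)    rewrite e = posDist-≤-enter j (branch v) (depth v)
  palmDist-step v (leg-hub j t e)    rewrite e = posDist-≤-leave j (branch v) (depth v)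
  palmDist-step v (leg-next j s t e) rewrite e = posDist-≤-outer j (suc (toℕ s)) (branch v) (depth v)
  palmDist-step v (leg-prev j s t e) rewrite e = posDist-≤-inner j (suc (toℕ t)) (branch v) (depth v)

  walk-down : ∀ k j (t s : Fin (b j)) → toℕ t ≡ k + toℕ s → Walk (Palm b) (leg j t) (leg j s) k
  walk-down zero    j t s e = subst (λ s′ → Walk (Palm b) (leg j t) (leg j s′) 0) (toℕ-injective e) here
  walk-down (suc k) j t s e = step (leg-prev j t t′ t≡1+t′) (walk-down k j t′ s (toℕ-fromℕ< k+s<bj))
    where
    k+s<bj : k + toℕ s < b j
    k+s<bj = ℕₚ.<-trans (ℕₚ.n<1+n _) (subst (_< b j) e (toℕ<n t))
    t′ = fromℕ< k+s<bj
    t≡1+t′ : toℕ t ≡ suc (toℕ t′)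
    t≡1+t′ = trans e (cong suc (sym (toℕ-fromℕ< k+s<bj)))

  walk-to-hub : ∀ j (t : Fin (b j)) → Walk (Palm b) (leg j t) hub (suc (toℕ t))
  walk-to-hub j t = subst (Walk (Palm b) (leg j t) hub) (ℕₚ.+-comm (toℕ t) 1)
                      (walk-append (walk-down (toℕ t) j t s₀ t≡t+0) last-edge)
    where
    0<bj : 0 < b j
    0<bj = ℕₚ.≤-<-trans z≤n (toℕ<n t)
    s₀ = fromℕ< 0<bj
    t≡t+0 : toℕ t ≡ toℕ t + toℕ s₀
    t≡t+0 = trans (sym (ℕₚ.+-identityʳ _)) (cong (toℕ t +_) (sym (toℕ-fromℕ< 0<bj)))
    last-edge : Walk (Palm b) (leg j s₀) hub 1
    last-edge = step (leg-hub j s₀ (toℕ-fromℕ< 0<bj)) here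

  palmDist-walk : ∀ u v → Walk (Palm b) u v (palmDist u v)
  palmDist-walk hub       hub       = here
  palmDist-walk hub       (leg l r) = walk-reverse Adj-sym (walk-to-hub l r)
  palmDist-walk (leg j t) hub       = walk-to-hub j t
  palmDist-walk (leg j t) (leg l r) with j ≟ l
  ... | no _ = walk-append (walk-to-hub j t) (walk-reverse Adj-sym (walk-to-hub l r))
  ... | yes refl with ℕₚ.≤-total (toℕ t) (toℕ r)
  ...   | inj₁ t≤r = subst (Walk (Palm b) (leg j t) (leg j r)) (sym (ℕₚ.m≤n⇒∣m-n∣≡n∸m t≤r))
                       (walk-reverse Adj-sym (walk-down _ j r t (sym (ℕₚ.m∸n+n≡m t≤r))))
  ...   | inj₂ r≤t = subst (Walk (Palm b) (leg j t) (leg j r)) (sym (ℕₚ.m≤n⇒∣n-m∣≡n∸m r≤t))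
                       (walk-down _ j t r (sym (ℕₚ.m∸n+n≡m r≤t)))

  palmDist-exact : ∀ u v → Dist (Palm b) u v (palmDist u v)
  palmDist-exact u v = palmDist-walk u v , λ _ → walk-length-≥ palmDist palmDist-self palmDist-step {u} {v}

  open FiniteMetricGraph (Palm b) vertices ∈-vertices palmDist palmDist-exact public

module Lengthening {n : ℕ} (a : Fin n → ℕ) (i : Fin n) (pos : 1 ≤ a i) where
  module G  = PalmMetric a
  module G′ = PalmMetric (lengthen a i)

  embedIndex : ∀ j → Fin (a j) → Fin (lengthen a i j)
  embedIndex j t with j ≟ i
  ... | yes _ = inject₁ t
  ... | no  _ = t

  toℕ-embedIndex : ∀ j t → toℕ (embedIndex j t) ≡ toℕ t
  toℕ-embedIndex j t with j ≟ i
  ... | yes _ = toℕ-inject₁ t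
  ... | no  _ = refl

  embed : PalmV a → PalmV (lengthen a i)
  embed hub       = hub
  embed (leg j t) = leg j (embedIndex j t)

  branch-embed : ∀ u → branch (embed u) ≡ branch u
  branch-embed hub       = refl
  branch-embed (leg j t) = refl

  depth-embed : ∀ u → depth (embed u) ≡ depth u
  depth-embed hub       = refl
  depth-embed (leg j t) = cong suc (toℕ-embedIndex j t)

  palmDist-embed : ∀ u v → palmDist (embed u) (embed v) ≡ palmDist u v
  palmDist-embed u v = palmDist-by-position (branch-embed u) (depth-embed u) (branch-embed v) (depth-embed v)

  embed-injective : ∀ {u v} → embed u ≡ embed v → u ≡ v
  embed-injective {u} {v} e =
    G.≡-by-position u v (trans (sym (branch-embed u)) (trans (cong branch e) (branch-embed v)))
                        (trans (sym (depth-embed u)) (trans (cong depth e) (depth-embed v)))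

  embed-Adj : ∀ {u v} → PalmAdj a u v → PalmAdj (lengthen a i) (embed u) (embed v)
  embed-Adj (hub-leg j t e) = hub-leg j (embedIndex j t) (trans (toℕ-embedIndex j t) e)
  embed-Adj (leg-hub j t e) = leg-hub j (embedIndex j t) (trans (toℕ-embedIndex j t) e)
  embed-Adj (leg-next j s t e) =
    leg-next j _ _ (trans (toℕ-embedIndex j t) (trans e (cong suc (sym (toℕ-embedIndex j s)))))
  embed-Adj (leg-prev j s t e) =
    leg-prev j _ _ (trans (toℕ-embedIndex j s) (trans e (cong suc (sym (toℕ-embedIndex j t)))))

  IsNewTip : PalmV (lengthen a i) → Set
  IsNewTip z = branch z ≡ just i × depth z ≡ suc (a i)

  lengthen-cases : ∀ j → lengthen a i j ≡ a j ⊎ (j ≡ i × lengthen a i j ≡ suc (a j))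
  lengthen-cases j with j ≟ i
  ... | yes j≡i = inj₂ (j≡i , refl)
  ... | no  _   = inj₁ refl

  embed-leg : ∀ j (t : Fin (lengthen a i j)) → toℕ t < a j → Σ (PalmV a) λ w → embed w ≡ leg j t
  embed-leg j t t<aj = leg j (fromℕ< t<aj) ,
    G′.≡-by-position _ _ refl (cong suc (trans (toℕ-embedIndex j _) (toℕ-fromℕ< t<aj)))

  embed-or-newTip : ∀ z → (Σ (PalmV a) λ w → embed w ≡ z) ⊎ IsNewTip z
  embed-or-newTip hub = inj₁ (hub , refl)
  embed-or-newTip (leg j t) with lengthen-cases j
  ... | inj₁ len≡ = inj₁ (embed-leg j t (subst (toℕ t <_) len≡ (toℕ<n t)))
  ... | inj₂ (refl , len≡) with toℕ t ℕ.≟ a j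
  ...   | yes t≡aj = inj₂ (refl , cong suc t≡aj)
  ...   | no  t≢aj =
    inj₁ (embed-leg j t (ℕₚ.≤∧≢⇒< (ℕ.s≤s⁻¹ (subst (toℕ t <_) len≡ (toℕ<n t))) t≢aj))

  oldTip : PalmV a
  oldTip = leg i (fromℕ< (ℕₚ.≤-reflexive (ℕₚ.suc-pred (a i) {{>-nonZero pos}})))

  depth-oldTip : depth oldTip ≡ a i
  depth-oldTip = trans (cong suc (toℕ-fromℕ< _)) (ℕₚ.suc-pred (a i) {{>-nonZero pos}})

  posDist-to-newTip : ∀ (u : PalmV a) →
    posDist (branch u) (depth u) (just i) (suc (a i)) ≡ suc (posDist (branch u) (depth u) (just i) (a i))
  posDist-to-newTip hub = refl
  posDist-to-newTip (leg j t) with j ≟ i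
  ... | yes refl = m≤n⇒∣m-1+n∣≡1+∣m-n∣ (toℕ<n t)
  ... | no  _    = ℕₚ.+-suc (suc (toℕ t)) (a i)

  palmDist-oldTip : ∀ (u : PalmV a) → palmDist u oldTip ≡ posDist (branch u) (depth u) (just i) (a i)
  palmDist-oldTip u = palmDist-by-position {u = u} {v = oldTip} refl refl refl depth-oldTip

  palmDist-newTip : ∀ u z → IsNewTip z → palmDist (embed u) z ≡ suc (palmDist u oldTip)
  palmDist-newTip u z (branch-z , depth-z) = begin
    palmDist (embed u) z                               ≡⟨ palmDist-by-position (branch-embed u) (depth-embed u) branch-z depth-z ⟩
    posDist (branch u) (depth u) (just i) (suc (a i))  ≡⟨ posDist-to-newTip u ⟩
    suc (posDist (branch u) (depth u) (just i) (a i))  ≡⟨ cong suc (palmDist-oldTip u) ⟨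
    suc (palmDist u oldTip)                            ∎
    where open ≡-Reasoning

  module _ (u v : PalmV a) (same : palmDist u oldTip ≡ palmDist v oldTip) where
    equidistant-newTip : ∀ z → IsNewTip z → palmDist (embed u) z ≡ palmDist (embed v) z
    equidistant-newTip z newTip =
      trans (palmDist-newTip u z newTip) (trans (cong suc same) (sym (palmDist-newTip v z newTip)))

    equidistant-oldTip : palmDist (embed u) (embed oldTip) ≡ palmDist (embed v) (embed oldTip)
    equidistant-oldTip = trans (palmDist-embed u oldTip) (trans same (sym (palmDist-embed v oldTip)))

  module Restriction (k′ : ℕ) (c′ : PalmV (lengthen a i) → Fin k′)
                     (proper′ : Proper (Palm (lengthen a i)) c′)
                     (codes′ : CodesDistinct (Palm (lengthen a i)) c′) where
    open G using (_≟ᵥ_)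

    c : PalmV a → Fin (suc k′)
    c v with v ≟ᵥ oldTip
    ... | yes _ = fromℕ k′
    ... | no  _ = inject₁ (c′ (embed v))

    c-oldTip : c oldTip ≡ fromℕ k′
    c-oldTip with oldTip ≟ᵥ oldTip
    ... | yes _ = refl
    ... | no ≢  = ⊥-elim (≢ refl)

    c-other : ∀ v → v ≢ oldTip → c v ≡ inject₁ (c′ (embed v))
    c-other v v≢ with v ≟ᵥ oldTip
    ... | yes v≡ = ⊥-elim (v≢ v≡)
    ... | no  _  = refl

    c-fresh⁻¹ : ∀ w → c w ≡ fromℕ k′ → w ≡ oldTip
    c-fresh⁻¹ w cw with w ≟ᵥ oldTip
    ... | yes w≡ = w≡
    ... | no  _  = ⊥-elim (fromℕ≢inject₁ (sym cw))

    c-old⁻¹ : ∀ w j → c w ≡ inject₁ j → c′ (embed w) ≡ j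
    c-old⁻¹ w j cw with w ≟ᵥ oldTip
    ... | yes _ = ⊥-elim (fromℕ≢inject₁ cw)
    ... | no  _ = inject₁-injective cw

    proper : Proper (Palm a) c
    proper u v e cu≡cv with u ≟ᵥ oldTip | v ≟ᵥ oldTip
    ... | yes refl | yes refl = G.Adj-irrefl e refl
    ... | yes _    | no  _    = fromℕ≢inject₁ cu≡cv
    ... | no  _    | yes _    = fromℕ≢inject₁ (sym cu≡cv)
    ... | no  _    | no  _    = proper′ (embed u) (embed v) (embed-Adj e) (inject₁-injective cu≡cv)

    fresh-DistSet : ∀ x → DistSet (Palm a) x (ColorClass (Palm a) c (fromℕ k′)) (palmDist x oldTip)
    fresh-DistSet x = G.DistSet-of-nearest oldTip c-oldTip
                        λ w cw → ℕₚ.≤-reflexive (cong (palmDist x) (sym (c-fresh⁻¹ w cw)))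

    embed-Within⊆ : ∀ u v j → palmDist u oldTip ≡ palmDist v oldTip →
      G.Within u (ColorClass (Palm a) c (inject₁ j)) ⊆ G.Within v (ColorClass (Palm a) c (inject₁ j)) →
      G′.Within (embed u) (ColorClass (Palm (lengthen a i)) c′ j) ⊆
      G′.Within (embed v) (ColorClass (Palm (lengthen a i)) c′ j)
    embed-Within⊆ u v j same u⊆v {k} (z , c′z , dz≤k) with embed-or-newTip z
    ... | inj₂ newTip = z , c′z , subst (_≤ k) (equidistant-newTip u v same z newTip) dz≤k
    ... | inj₁ (w , refl) with w ≟ᵥ oldTip
    ...   | yes refl = embed oldTip , c′z , subst (_≤ k) (equidistant-oldTip u v same) dz≤k
    ...   | no w≢ =
            let w′ , cw′ , dw′≤k = u⊆v (w , trans (c-other w w≢) (cong inject₁ c′z) ,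
                                           subst (_≤ k) (palmDist-embed u w) dz≤k)
            in embed w′ , c-old⁻¹ w′ j cw′ , subst (_≤ k) (sym (palmDist-embed v w′)) dw′≤k

    codes : CodesDistinct (Palm a) c
    codes u v u≢v with palmDist u oldTip ℕ.≟ palmDist v oldTip
    ... | no du≢dv = fromℕ k′ , _ , _ , fresh-DistSet u , fresh-DistSet v , du≢dv
    ... | yes same with codes′ (embed u) (embed v) (u≢v ∘ embed-injective)
    ...   | j , m , m′ , dsu , dsv , m≢m′ with G.separates-or-Within-≡ u v (λ w → c w ≟ inject₁ j)
    ...     | inj₁ (p , q , du , dv , p≢q) = inject₁ j , p , q , du , dv , p≢q
    ...     | inj₂ (u⊆v , v⊆u) = ⊥-elim (m≢m′ (ℕₚ.≤-antisym
              (G′.Within⊆⇒DistSet≤ dsv dsu (embed-Within⊆ v u j (sym same) v⊆u))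
              (G′.Within⊆⇒DistSet≤ dsu dsv (embed-Within⊆ u v j same u⊆v))))

  restrictLocatingColoring : ∀ {k′} → HasLocatingColoring (Palm (lengthen a i)) k′ →
                             Σ ℕ λ M → M ≤ suc k′ × HasLocatingColoring (Palm a) M
  restrictLocatingColoring {k′} (c′ , proper′ , _ , codes′) =
    UnusedColors.dropUnusedColors (Palm a) G.vertices G.∈-vertices (suc k′) c proper codes
    where open Restriction k′ c′ proper′ codes′

lemma2 : (n : ℕ) → 2 ≤ n → (a : Fin n → ℕ) → (∀ j → 1 ≤ a j) → (i : Fin n) →
         (k k′ : ℕ) → IsLocChromNum (Palm a) k → IsLocChromNum (Palm (lengthen a i)) k′ →
         k ≤ k′ + 1
lemma2 n _ a pos i k k′ χ χ′ =
  let M , M≤1+k′ , hasM = Lengthening.restrictLocatingColoring a i (pos i) (proj₁ χ′)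
  in subst (k ≤_) (ℕₚ.+-comm 1 k′) (ℕₚ.≤-trans (IsLocChromNum⇒≤ χ hasM) M≤1+k′)
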